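{- Let $G$ be a connected graph. Then $D(G)\leq \dim(G)+1$.
   Context: For a connected graph $G$ with distance function $d$, a set $S\subseteq V(G)$ is a resolving set if for any two distinct vertices $g_1,g_2$ of $G$ there is $s\in S$ with $d(g_1,s)\neq d(g_2,s)$; the metric dimension $\dim(G)$ is the minimum size of a resolving set. The distinguishing number $D(G)$ is the minimum number of colours in a (not necessarily proper) vertex colouring of $G$ such that the identity is the only automorphism of $G$ preserving the colouring. -}

module Defs where

open import Data.Nat using (ℕ; zero; suc; _≤_)
open import Data.Fin using (Fin)
open import Data.Fin.Subset using (Subset; _∈_; ∣_∣)
open import Data.Fin.Permutation using (Permutation′; _⟨$⟩ʳ_)
open import Data.Product using (Σ; _×_; ∃; ∃-syntax; _,_)
open import Relation.Nullary using (¬_)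
open import Relation.Binary.PropositionalEquality using (_≡_; _≢_)

record Graph (n : ℕ) : Set₁ where
  field
    Adj    : Fin n → Fin n → Set
    sym    : ∀ {u v} → Adj u v → Adj v u
    irrefl : ∀ {u} → ¬ Adj u u
open Graph public

data Walk {n : ℕ} (G : Graph n) : Fin n → Fin n → ℕ → Set where
  nil  : ∀ {u} → Walk G u u 0
  cons : ∀ {u w v k} → Adj G u w → Walk G w v k → Walk G u v (suc k)

Connected : ∀ {n} → Graph n → Set
Connected G = ∀ u v → ∃[ k ] Walk G u v k

Dist : ∀ {n} → Graph n → Fin n → Fin n → ℕ → Set
Dist G u v k = Walk G u v k × (∀ j → Walk G u v j → k ≤ j)

Resolving : ∀ {n} → Graph n → Subset n → Set
Resolving {n} G S =
  ∀ (g₁ g₂ : Fin n) → g₁ ≢ g₂ →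
    ∃[ s ] (s ∈ S × ∃[ a ] ∃[ b ] (Dist G g₁ s a × Dist G g₂ s b × a ≢ b))

IsMetricDim : ∀ {n} → Graph n → ℕ → Set
IsMetricDim G k =
  (∃[ S ] (Resolving G S × ∣ S ∣ ≡ k)) × (∀ S → Resolving G S → k ≤ ∣ S ∣)

IsAutomorphism : ∀ {n} → Graph n → Permutation′ n → Set
IsAutomorphism {n} G π =
  ∀ (u v : Fin n) → (Adj G u v → Adj G (π ⟨$⟩ʳ u) (π ⟨$⟩ʳ v))
                  × (Adj G (π ⟨$⟩ʳ u) (π ⟨$⟩ʳ v) → Adj G u v)

-- A colouring with m colours (not necessarily proper) is distinguishing if the
-- identity is the only automorphism preserving it.
Distinguishing : ∀ {n m} → Graph n → (Fin n → Fin m) → Set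
Distinguishing {n} G c =
  ∀ (π : Permutation′ n) → IsAutomorphism G π →
    (∀ v → c (π ⟨$⟩ʳ v) ≡ c v) → ∀ v → π ⟨$⟩ʳ v ≡ v

IsDistinguishingNumber : ∀ {n} → Graph n → ℕ → Set
IsDistinguishingNumber {n} G m =
  (Σ (Fin n → Fin m) (Distinguishing G))
  × (∀ m′ → (c : Fin n → Fin m′) → Distinguishing G c → m ≤ m′)

-- An automorphism preserves distances, so one that fixes a resolving set S
-- pointwise fixes every vertex: if it moved v, the vertices σ v and v would
-- have the same distance to each s ∈ S. Colouring the vertices of S with
-- pairwise distinct colours and all other vertices with one further colour
-- therefore gives a distinguishing colouring with ∣ S ∣ + 1 colours.
module Submission where

open import Defs hiding (sym)
open import Data.Nat using (ℕ; suc; _≤_)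
open import Data.Nat.Properties using (≤-antisym)
open import Data.Bool using (true; false)
open import Data.Fin using (Fin; zero; suc; fromℕ; inject₁)
open import Data.Fin.Properties using (inject₁-injective; fromℕ≢inject₁; _≟_)
open import Data.Fin.Subset using (Subset; _∈_; ∣_∣)
open import Data.Fin.Permutation using (Permutation′; _⟨$⟩ʳ_; _⟨$⟩ˡ_; flip; inverseˡ; inverseʳ)
open import Data.Vec.Base using (_∷_; here; there)
open import Data.Product using (_,_; proj₁; proj₂)
open import Data.Empty using (⊥-elim)
open import Relation.Nullary using (yes; no)
open import Relation.Binary.PropositionalEquality using (_≡_; _≢_; refl; sym; cong; subst; subst₂)

-- Members of S get pairwise distinct non-zero colours, all other vertices colour 0.
colourBy : ∀ {n} (S : Subset n) → Fin n → Fin (suc ∣ S ∣)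
colourBy (false ∷ S) zero    = zero
colourBy (false ∷ S) (suc v) = colourBy S v
colourBy (true  ∷ S) zero    = fromℕ _
colourBy (true  ∷ S) (suc v) = inject₁ (colourBy S v)

colourBy-∈⇒≢0 : ∀ {n} (S : Subset n) {s} → s ∈ S → colourBy S s ≢ zero
colourBy-∈⇒≢0 (true  ∷ S) (there s∈S) c≡0 = colourBy-∈⇒≢0 S s∈S (inject₁≡0⇒≡0 _ c≡0)
  where
  inject₁≡0⇒≡0 : ∀ {m} (x : Fin (suc m)) → inject₁ x ≡ zero → x ≡ zero
  inject₁≡0⇒≡0 zero _ = refl
colourBy-∈⇒≢0 (false ∷ S) (there s∈S) c≡0 = colourBy-∈⇒≢0 S s∈S c≡0

colourBy-injectiveOn : ∀ {n} (S : Subset n) {s} v → s ∈ S →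
                       colourBy S v ≡ colourBy S s → v ≡ s
colourBy-injectiveOn (true  ∷ S) zero    here        _  = refl
colourBy-injectiveOn (true  ∷ S) (suc v) here        eq = ⊥-elim (fromℕ≢inject₁ (sym eq))
colourBy-injectiveOn (true  ∷ S) zero    (there _)   eq = ⊥-elim (fromℕ≢inject₁ eq)
colourBy-injectiveOn (true  ∷ S) (suc v) (there s∈S) eq =
  cong suc (colourBy-injectiveOn S v s∈S (inject₁-injective eq))
colourBy-injectiveOn (false ∷ S) zero    (there s∈S) eq = ⊥-elim (colourBy-∈⇒≢0 S s∈S (sym eq))
colourBy-injectiveOn (false ∷ S) (suc v) (there s∈S) eq =
  cong suc (colourBy-injectiveOn S v s∈S eq)

Dist-unique : ∀ {n} (G : Graph n) {u v a b} → Dist G u v a → Dist G u v b → a ≡ b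
Dist-unique G (wa , minA) (wb , minB) = ≤-antisym (minA _ wb) (minB _ wa)

module _ {n : ℕ} {G : Graph n} where

  Walk-map : ∀ σ → IsAutomorphism G σ →
             ∀ {u v k} → Walk G u v k → Walk G (σ ⟨$⟩ʳ u) (σ ⟨$⟩ʳ v) k
  Walk-map σ aut nil                = nil
  Walk-map σ aut (cons {u} {w} e p) = cons (proj₁ (aut u w) e) (Walk-map σ aut p)

  IsAutomorphism-flip : ∀ σ → IsAutomorphism G σ → IsAutomorphism G (flip σ)
  IsAutomorphism-flip σ aut u v =
      (λ e → proj₂ (aut (σ ⟨$⟩ˡ u) (σ ⟨$⟩ˡ v)) (subst₂ (Adj G) (sym (inverseʳ σ)) (sym (inverseʳ σ)) e))
    , (λ e → subst₂ (Adj G) (inverseʳ σ) (inverseʳ σ) (proj₁ (aut (σ ⟨$⟩ˡ u) (σ ⟨$⟩ˡ v)) e))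

  Dist-map : ∀ σ → IsAutomorphism G σ →
             ∀ {u v a} → Dist G u v a → Dist G (σ ⟨$⟩ʳ u) (σ ⟨$⟩ʳ v) a
  Dist-map σ aut (w , minimal) = Walk-map σ aut w , λ j w′ →
    minimal j (subst₂ (λ x y → Walk G x y j) (inverseˡ σ) (inverseˡ σ)
                      (Walk-map (flip σ) (IsAutomorphism-flip σ aut) w′))

  fixesResolving⇒identity : ∀ {S} → Resolving G S →
    ∀ σ → IsAutomorphism G σ → (∀ s → s ∈ S → σ ⟨$⟩ʳ s ≡ s) → ∀ v → σ ⟨$⟩ʳ v ≡ v
  fixesResolving⇒identity res σ aut fixS v with σ ⟨$⟩ʳ v ≟ v
  ... | yes σv≡v = σv≡v
  ... | no  σv≢v with res (σ ⟨$⟩ʳ v) v σv≢v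
  ... | s , s∈S , a , b , dσv , dv , a≢b =
    ⊥-elim (a≢b (Dist-unique G dσv dσvs))
    where
    dσvs : Dist G (σ ⟨$⟩ʳ v) s b
    dσvs = subst (λ x → Dist G (σ ⟨$⟩ʳ v) x b) (fixS s s∈S) (Dist-map σ aut dv)

  colourBy-distinguishing : ∀ {S} → Resolving G S → Distinguishing G (colourBy S)
  colourBy-distinguishing {S} res σ aut preserves =
    fixesResolving⇒identity res σ aut λ s s∈S → colourBy-injectiveOn S (σ ⟨$⟩ʳ s) s∈S (preserves s)

mainTheorem1 : ∀ (n : ℕ) (G : Graph n) → Connected G →
    ∀ (k m : ℕ) → IsMetricDim G k → IsDistinguishingNumber G m → m ≤ suc k
mainTheorem1 n G _ k m ((S , res , ∣S∣≡k) , _) (_ , minimal) =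
  subst (λ i → m ≤ suc i) ∣S∣≡k (minimal _ (colourBy S) (colourBy-distinguishing res))
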